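{- Let $\alpha,\beta,\gamma\ge2$ be integers. If either $\alpha=2$ and $\beta,\gamma$ are even; or $\alpha,\beta\ge4$ are even and $\gamma\ne3$; or $\alpha,\beta\ge3$ are odd and $\gamma\ge3$, then $\Theta(\alpha,\beta,\gamma)$ admits a Tanaka quintuple $(v_1,\dots,v_5)$ with $v_5$ a vertex of the path $(z_0,\dots,z_\gamma)$. In particular, if $\alpha,\beta,\gamma\ge4$ then $\Theta(\alpha,\beta,\gamma)$ admits a Tanaka quintuple.
   Context: For a connected graph $G=(V,E)$ with graph distance $d$, a Tanaka quintuple is a sequence of vertices $(v_1,v_2,v_3,v_4,v_5)$ with $\{v_1,v_2\},\{v_3,v_4\}\in E$, $d(v_1,v_3)=d(v_2,v_4)=d(v_1,v_4)-1=d(v_2,v_3)-1$, $d(v_5,v_2)=d(v_5,v_1)+1$ and $d(v_5,v_3)=d(v_5,v_4)+1$. For integers $\alpha,\beta,\gamma\ge1$ with at most one equal to $1$, the theta graph $\Theta(\alpha,\beta,\gamma)$ is obtained from three paths $(x_0,\dots,x_\alpha)$, $(y_0,\dots,y_\beta)$, $(z_0,\dots,z_\gamma)$ by identifying $x_0=y_0=z_0$ and $x_\alpha=y_\beta=z_\gamma$, all other vertices being distinct. -}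

module Defs where

open import Data.Nat using (ℕ; zero; suc; pred; _≤_; _<_; _<?_)
open import Data.Nat.Properties using (≤-pred)
open import Data.Fin using (Fin; fromℕ<)
open import Data.Product using (Σ; _×_; _,_; ∃)
open import Data.Sum using (_⊎_)
open import Relation.Nullary using (yes; no)
open import Relation.Binary.PropositionalEquality using (_≡_)

data Walk {V : Set} (E : V → V → Set) : V → V → ℕ → Set where
  here : ∀ {u} → Walk E u u zero
  step : ∀ {u w v n} → E u w → Walk E w v n → Walk E u v (suc n)

Dist : {V : Set} → (V → V → Set) → V → V → ℕ → Set
Dist E u v n = Walk E u v n × (∀ m → Walk E u v m → n ≤ m)

TanakaQuintuple : {V : Set} → (V → V → Set) → V → V → V → V → V → Set
TanakaQuintuple E v1 v2 v3 v4 v5 =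
  E v1 v2 × E v3 v4 ×
  (Σ ℕ λ k → Dist E v1 v3 k × Dist E v2 v4 k
           × Dist E v1 v4 (suc k) × Dist E v2 v3 (suc k)) ×
  (Σ ℕ λ m → Dist E v5 v1 m × Dist E v5 v2 (suc m)) ×
  (Σ ℕ λ m → Dist E v5 v4 m × Dist E v5 v3 (suc m))

data Tag : Set where
  X Y Z : Tag

len : ℕ → ℕ → ℕ → Tag → ℕ
len α β γ X = α
len α β γ Y = β
len α β γ Z = γ

-- Vertices: the common start x_0 = y_0 = z_0, the common end
-- x_α = y_β = z_γ, and the interior vertices of each path;
-- inner p i stands for the vertex of index 1 + i on path p.
data ThetaV (α β γ : ℕ) : Set where
  start : ThetaV α β γ
  end   : ThetaV α β γ
  inner : (p : Tag) → Fin (pred (len α β γ p)) → ThetaV α β γ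

-- pathV p i : the vertex with index i on path p (meaningful for i ≤ length of p).
pathV : ∀ {α β γ} → Tag → ℕ → ThetaV α β γ
pathV p zero = start
pathV {α} {β} {γ} p (suc i) with suc i <? len α β γ p
... | yes lt = inner p (fromℕ< (≤-pred′ lt))
  where
  ≤-pred′ : ∀ {a b} → suc a < b → a < pred b
  ≤-pred′ {a} {suc b} (Data.Nat.s≤s q) = q
... | no _   = end

ThetaAdj : (α β γ : ℕ) → ThetaV α β γ → ThetaV α β γ → Set
ThetaAdj α β γ u v =
  Σ Tag λ p → Σ ℕ λ i → suc i ≤ len α β γ p ×
    ((pathV p i ≡ u × pathV p (suc i) ≡ v) ⊎ (pathV p i ≡ v × pathV p (suc i) ≡ u))

AdmitsTanakaWith : (α β γ : ℕ) → (ThetaV α β γ → Set) → Set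
AdmitsTanakaWith α β γ P =
  Σ (ThetaV α β γ) λ v1 → Σ (ThetaV α β γ) λ v2 → Σ (ThetaV α β γ) λ v3 →
  Σ (ThetaV α β γ) λ v4 → Σ (ThetaV α β γ) λ v5 →
    TanakaQuintuple (ThetaAdj α β γ) v1 v2 v3 v4 v5 × P v5

OnZPath : ∀ {α β γ} → ThetaV α β γ → Set
OnZPath {α} {β} {γ} v = Σ ℕ λ k → k ≤ γ × pathV Z k ≡ v

-- Take an edge v₁v₂ = P_i P_{i+1} on a path P, an edge v₃v₄ = Q_{j+δ} Q_{j+δ+1}
-- on a second path Q and the vertex v₅ = R_k on the third path R, where
-- |P| = 2i + δ + 1, |Q| = 2j + δ + 1 and |R| = 2k + e with e < δ, and where
-- every path has length at least δ + 1.  Then v₁, v₂ lie nearer the start of Θ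
-- and v₃, v₄ nearer the end: d(v₁,v₃) = i + j + δ is realised through the
-- start, d(v₂,v₄) = i + j + δ through the end, and both crossed pairs are one
-- step further apart.  The vertex v₅, in the middle of R up to e, reaches P
-- through the start and Q through the end, which gives the last two
-- conditions.  The parity hypotheses are exactly what allows solving for
-- i, j, k, e and δ.
--
-- Every distance used is between vertices on different paths, and is the
-- shorter of the two walks through the start and through the end.  The lower
-- bound comes from a potential on Θ that vanishes at the source and grows by
-- at most one along every edge.

module Submission where

open import Defs
open import Data.Empty using (⊥-elim)
open import Data.Fin using (toℕ)
open import Data.Fin.Properties using (toℕ-fromℕ<)
open import Data.List using (_∷_; [])
open import Data.Nat
  using (ℕ; zero; suc; _+_; _*_; _∸_; _⊓_; _≤_; _<_; _<?_; z≤n; s≤s; s≤s⁻¹; ∣_-_∣)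
open import Data.Nat.Divisibility using (_∣_; _∣?_; divides; ∣-refl; ∣m∣n⇒∣m+n)
open import Data.Nat.Properties
open import Data.Nat.Tactic.RingSolver using (solve)
open import Data.Product using (Σ; _×_; _,_; proj₁; proj₂)
open import Data.Sum using (_⊎_; inj₁; inj₂)
open import Data.Unit using (⊤; tt)
open import Function using (_∘_)
open import Relation.Nullary using (¬_; Dec; yes; no)
open import Relation.Binary.PropositionalEquality
  using (_≡_; _≢_; refl; sym; trans; cong; subst; module ≡-Reasoning)

private variable
  V : Set
  Edge : V → V → Set
  u v w : V
  m n : ℕ

_▷_ : Walk Edge u v n → Edge v w → Walk Edge u w (suc n)
here     ▷ e′ = step e′ here
step e p ▷ e′ = step e (p ▷ e′)

_++_ : Walk Edge u v m → Walk Edge v w n → Walk Edge u w (m + n)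
here     ++ q = q
step e p ++ q = step e (p ++ q)

reverse : (∀ {x y} → Edge x y → Edge y x) → Walk Edge u v n → Walk Edge v u n
reverse edge-sym here       = here
reverse edge-sym (step e p) = reverse edge-sym p ▷ edge-sym e

Lipschitz : (V → V → Set) → (V → ℕ) → Set
Lipschitz Edge f = ∀ {x y} → Edge x y → f y ≤ suc (f x)

lipschitz-walk : ∀ {f : V → ℕ} → Lipschitz Edge f → Walk Edge u v n → f v ≤ f u + n
lipschitz-walk lip here = m≤m+n _ 0
lipschitz-walk {n = suc n} lip (step e p) = begin
  _             ≤⟨ lipschitz-walk lip p ⟩
  _ + n         ≤⟨ +-monoˡ-≤ n (lip e) ⟩
  suc (_ + n)   ≡⟨ sym (+-suc _ n) ⟩
  _ + suc n     ∎
  where open ≤-Reasoning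

Lipschitzℕ : (ℕ → ℕ) → Set
Lipschitzℕ g = ∀ t → g (suc t) ≤ suc (g t) × g t ≤ suc (g (suc t))

id-lipschitz : Lipschitzℕ (λ t → t)
id-lipschitz t = ≤-refl , ≤-trans (n≤1+n t) (n≤1+n (suc t))

+-lipschitz : ∀ c {g} → Lipschitzℕ g → Lipschitzℕ (λ t → c + g t)
+-lipschitz c {g} lip t =
  shift (proj₁ (lip t)) , shift (proj₂ (lip t))
  where
  shift : ∀ {x y} → x ≤ suc y → c + x ≤ suc (c + y)
  shift {x} {y} x≤ = subst (c + x ≤_) (+-suc c y) (+-monoʳ-≤ c x≤)

∸-lipschitz : ∀ c → Lipschitzℕ (c ∸_)
∸-lipschitz c t = ≤-trans (∸-monoʳ-≤ c (n≤1+n t)) (n≤1+n (c ∸ t)) , one-step c t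
  where
  one-step : ∀ c t → c ∸ t ≤ suc (c ∸ suc t)
  one-step zero    zero    = z≤n
  one-step zero    (suc t) = z≤n
  one-step (suc c) zero    = ≤-refl
  one-step (suc c) (suc t) = one-step c t

⊓-lipschitz : ∀ {f g} → Lipschitzℕ f → Lipschitzℕ g → Lipschitzℕ (λ t → f t ⊓ g t)
⊓-lipschitz lf lg t =
  ⊓-mono-≤ (proj₁ (lf t)) (proj₁ (lg t)) , ⊓-mono-≤ (proj₂ (lf t)) (proj₂ (lg t))

∣n-1+n∣≡1 : ∀ n → ∣ n - suc n ∣ ≡ 1
∣n-1+n∣≡1 zero    = refl
∣n-1+n∣≡1 (suc n) = ∣n-1+n∣≡1 n

∣-∣-lipschitz : ∀ c → Lipschitzℕ (∣ c -_∣)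
∣-∣-lipschitz c t =
  via t (suc t) (∣n-1+n∣≡1 t) , via (suc t) t (trans (∣-∣-comm (suc t) t) (∣n-1+n∣≡1 t))
  where
  via : ∀ s s′ → ∣ s - s′ ∣ ≡ 1 → ∣ c - s′ ∣ ≤ suc ∣ c - s ∣
  via s s′ eq = begin
    ∣ c - s′ ∣               ≤⟨ ∣-∣-triangle c s s′ ⟩
    ∣ c - s ∣ + ∣ s - s′ ∣   ≡⟨ cong (∣ c - s ∣ +_) eq ⟩
    ∣ c - s ∣ + 1            ≡⟨ +-comm _ 1 ⟩
    suc ∣ c - s ∣            ∎
    where open ≤-Reasoning

m+o≡n⇒m≤n : ∀ {m n} o → m + o ≡ n → m ≤ n
m+o≡n⇒m≤n {m} o refl = m≤m+n m o

∤2⇒odd : ∀ n → ¬ 2 ∣ n → Σ ℕ λ k → n ≡ 1 + 2 * k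
∤2⇒odd zero          ∤ = ⊥-elim (∤ (divides 0 refl))
∤2⇒odd (suc zero)    _ = 0 , refl
∤2⇒odd (suc (suc n)) ∤ with ∤2⇒odd n (∤ ∘ ∣m∣n⇒∣m+n ∣-refl)
... | k , refl = suc k , solve (k ∷ [])

2*-split : ∀ {c k} → 2 * c ≤ 2 * k → 2 * k ≡ 2 * c + 2 * (k ∸ c)
2*-split {c} {k} le = begin
  2 * k                ≡⟨ cong (2 *_) (sym (m+[n∸m]≡n (*-cancelˡ-≤ {c} {k} 2 le))) ⟩
  2 * (c + (k ∸ c))    ≡⟨ *-distribˡ-+ 2 c (k ∸ c) ⟩
  2 * c + 2 * (k ∸ c)  ∎
  where open ≡-Reasoning

even-≥ : ∀ c {n} → 2 ∣ n → 2 * c ≤ n → Σ ℕ λ j → n ≡ 2 * c + 2 * j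
even-≥ c (divides k refl) le rewrite *-comm k 2 = k ∸ c , 2*-split {c} {k} le

odd-≥ : ∀ c {n} → ¬ 2 ∣ n → 1 + 2 * c ≤ n → Σ ℕ λ j → n ≡ 1 + 2 * c + 2 * j
odd-≥ c {n} ∤ le with ∤2⇒odd n ∤
... | k , refl = k ∸ c , cong suc (2*-split {c} {k} (s≤s⁻¹ le))

4≤-odd≢3 : ∀ {n} → 2 ≤ n → ¬ 2 ∣ n → n ≢ 3 → 4 ≤ n
4≤-odd≢3 {1} (s≤s ()) _ _
4≤-odd≢3 {2} _ ∤ _  = ⊥-elim (∤ ∣-refl)
4≤-odd≢3 {3} _ _ ≢3 = ⊥-elim (≢3 refl)
4≤-odd≢3 {suc (suc (suc (suc n)))} _ _ _ = s≤s (s≤s (s≤s (s≤s z≤n)))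

_≟ᵗ_ : (S T : Tag) → Dec (S ≡ T)
X ≟ᵗ X = yes refl
X ≟ᵗ Y = no λ ()
X ≟ᵗ Z = no λ ()
Y ≟ᵗ X = no λ ()
Y ≟ᵗ Y = yes refl
Y ≟ᵗ Z = no λ ()
Z ≟ᵗ X = no λ ()
Z ≟ᵗ Y = no λ ()
Z ≟ᵗ Z = yes refl

weaken-admits : ∀ {α β γ} {A B : ThetaV α β γ → Set} → (∀ {v} → A v → B v) →
                AdmitsTanakaWith α β γ A → AdmitsTanakaWith α β γ B
weaken-admits A⇒B (v₁ , v₂ , v₃ , v₄ , v₅ , q , a) = v₁ , v₂ , v₃ , v₄ , v₅ , q , A⇒B a

module Theta (α β γ : ℕ) where

  G : Set
  G = ThetaV α β γ

  E : G → G → Set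
  E = ThetaAdj α β γ

  L : Tag → ℕ
  L = len α β γ

  for-all-paths : {A : ℕ → Set} → A α → A β → A γ → ∀ U → A (L U)
  for-all-paths a b c X = a
  for-all-paths a b c Y = b
  for-all-paths a b c Z = c

  OnPath : Tag → G → Set
  OnPath R v = Σ ℕ λ k → k ≤ L R × pathV R k ≡ v

  E-sym : ∀ {u v} → E u v → E v u
  E-sym (T , t , le , inj₁ p) = T , t , le , inj₂ p
  E-sym (T , t , le , inj₂ p) = T , t , le , inj₁ p

  path-edge : ∀ T t → suc t ≤ L T → E (pathV T t) (pathV T (suc t))
  path-edge T t le = T , t , le , inj₁ (refl , refl)

  split⇒≤ : ∀ {T t t′} → t + t′ ≡ L T → t ≤ L T
  split⇒≤ {t = t} {t′} eq = subst (t ≤_) eq (m≤m+n t t′)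

  pathV-last : ∀ T n → suc n ≡ L T → pathV {α} {β} {γ} T (suc n) ≡ end
  pathV-last T n eq with suc n <? len α β γ T
  ... | yes lt = ⊥-elim (<-irrefl eq lt)
  ... | no  _  = refl

  walk-to-start : ∀ T t → t ≤ L T → Walk E (pathV T t) start t
  walk-to-start T zero    _  = here
  walk-to-start T (suc t) le = step (E-sym (path-edge T t le)) (walk-to-start T t (<⇒≤ le))

  walk-to-end : ∀ T t t′ → t + t′ ≡ L T → 0 < L T → Walk E (pathV T t) end t′
  walk-to-end T zero    zero eq pos = ⊥-elim (<-irrefl eq pos)
  walk-to-end T (suc t) zero eq _   =
    subst (λ x → Walk E (pathV T (suc t)) x 0) (pathV-last T t (trans (sym (+-identityʳ _)) eq)) here
  walk-to-end T t (suc t′) eq pos =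
    step (path-edge T t (split⇒≤ eq′)) (walk-to-end T (suc t) t′ eq′ pos)
    where
    eq′ : suc t + t′ ≡ L T
    eq′ = trans (sym (+-suc t t′)) eq

  -- `balanced` makes i and i′ the true distances from the source P_i to the
  -- start and to the end: going around through another path is never shorter.
  module Potential (P : Tag) (i i′ : ℕ) (split : i + i′ ≡ L P)
                   (balanced : ∀ U → ∣ i - i′ ∣ ≤ L U) where

    height : Tag → ℕ → ℕ
    height T t with T ≟ᵗ P
    ... | yes _ = ∣ i - t ∣
    ... | no  _ = (i + t) ⊓ (i′ + (L T ∸ t))

    potential : G → ℕ
    potential start       = i
    potential end         = i′
    potential (inner T k) = height T (suc (toℕ k))

    height-lipschitz : ∀ T → Lipschitzℕ (height T)
    height-lipschitz T with T ≟ᵗ P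
    ... | yes _ = ∣-∣-lipschitz i
    ... | no  _ = ⊓-lipschitz (+-lipschitz i id-lipschitz) (+-lipschitz i′ (∸-lipschitz (L T)))

    height-start : ∀ T → height T 0 ≡ i
    height-start T with T ≟ᵗ P
    ... | yes _ = ∣-∣-identityʳ i
    ... | no  _ rewrite +-identityʳ i =
      m≤n⇒m⊓n≡m (≤-trans (m≤n+∣m-n∣ i i′) (+-monoʳ-≤ i′ (balanced T)))

    height-end : ∀ T → height T (L T) ≡ i′
    height-end T with T ≟ᵗ P
    ... | yes refl = subst (λ l → ∣ i - l ∣ ≡ i′) split (∣m-m+n∣≡n i i′)
    ... | no  _ rewrite n∸n≡0 (L T) | +-identityʳ i′ =
      m≥n⇒m⊓n≡n (≤-trans (m≤n+∣m-n∣ i′ i)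
                         (+-monoʳ-≤ i (subst (_≤ L T) (∣-∣-comm i i′) (balanced T))))

    potential-pathV : ∀ T t → t ≤ L T → potential (pathV T t) ≡ height T t
    potential-pathV T zero    _  = sym (height-start T)
    potential-pathV T (suc t) le with suc t <? len α β γ T
    ... | yes _  = cong (λ s → height T (suc s)) (toℕ-fromℕ< _)
    ... | no  ≮  = trans (sym (height-end T)) (cong (height T) (sym (≤∧≮⇒≡ le ≮)))

    potential-lipschitz : Lipschitz E potential
    potential-lipschitz (T , t , le , inj₁ (refl , refl))
      rewrite potential-pathV T t (<⇒≤ le) | potential-pathV T (suc t) le = proj₁ (height-lipschitz T t)
    potential-lipschitz (T , t , le , inj₂ (refl , refl))
      rewrite potential-pathV T t (<⇒≤ le) | potential-pathV T (suc t) le = proj₂ (height-lipschitz T t)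

    potential-source : potential (pathV P i) ≡ 0
    potential-source rewrite potential-pathV P i (split⇒≤ split) with P ≟ᵗ P
    ... | yes _ = ∣n-n∣≡0 i
    ... | no  P≢P = ⊥-elim (P≢P refl)

    potential-across : ∀ {T t t′} → T ≢ P → t + t′ ≡ L T →
                       potential (pathV T t) ≡ (i + t) ⊓ (i′ + t′)
    potential-across {T} {t} {t′} T≢P splitT
      rewrite potential-pathV T t (split⇒≤ splitT) with T ≟ᵗ P
    ... | yes T≡P = ⊥-elim (T≢P T≡P)
    ... | no  _   = cong (λ s → (i + t) ⊓ (i′ + s)) (subst (λ l → l ∸ t ≡ t′) splitT (m+n∸m≡n t t′))

    walk-across-≥ : ∀ {T t t′ m} → T ≢ P → t + t′ ≡ L T →
                    Walk E (pathV P i) (pathV T t) m → (i + t) ⊓ (i′ + t′) ≤ m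
    walk-across-≥ {T} {t} {t′} {m} T≢P splitT p = begin
      (i + t) ⊓ (i′ + t′)        ≡⟨ sym (potential-across T≢P splitT) ⟩
      potential (pathV T t)      ≤⟨ lipschitz-walk potential-lipschitz p ⟩
      potential (pathV P i) + m  ≡⟨ cong (_+ m) potential-source ⟩
      m                          ∎
      where open ≤-Reasoning

  module _ {P T : Tag} (T≢P : T ≢ P) (i i′ t t′ : ℕ) (splitP : i + i′ ≡ L P)
           (splitT : t + t′ ≡ L T) (balanced : ∀ U → ∣ i - i′ ∣ ≤ L U) where

    open Potential P i i′ splitP balanced using (walk-across-≥)

    -- Both side conditions are equations, so that callers discharge them by
    -- ring normalisation; s is the slack of the longer walk.
    dist-via-start : ∀ n s → n ≡ i + t → n + s ≡ i′ + t′ → Dist E (pathV P i) (pathV T t) n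
    dist-via-start _ s refl slack =
      walk-to-start P i (split⇒≤ splitP) ++ reverse E-sym (walk-to-start T t (split⇒≤ splitT)) ,
      λ m p → ≤-trans (⊓-glb ≤-refl (m+o≡n⇒m≤n s slack)) (walk-across-≥ T≢P splitT p)

    dist-via-end : (∀ U → 0 < L U) → ∀ n s → n ≡ i′ + t′ → n + s ≡ i + t →
                   Dist E (pathV P i) (pathV T t) n
    dist-via-end pos _ s refl slack =
      walk-to-end P i i′ splitP (pos P) ++ reverse E-sym (walk-to-end T t t′ splitT (pos T)) ,
      λ m p → ≤-trans (⊓-glb (m+o≡n⇒m≤n s slack) ≤-refl) (walk-across-≥ T≢P splitT p)

  tanaka-config : ∀ P Q R → Q ≢ P → P ≢ R → Q ≢ R → ∀ i j k e d δ → δ ≡ suc (e + d) →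
                  L P ≡ suc δ + 2 * i → L Q ≡ suc δ + 2 * j → L R ≡ e + 2 * k →
                  (∀ U → suc δ ≤ L U) → AdmitsTanakaWith α β γ (OnPath R)
  tanaka-config P Q R Q≢P P≢R Q≢R i j k e d δ refl hP hQ hR long =
    v₁ , v₂ , v₃ , v₄ , v₅ ,
    ( path-edge P i (split⇒≤ split₂) , path-edge Q (j + δ) (split⇒≤ split₄)
    , (i + (j + δ) , d₁₃ , d₂₄ , d₁₄ , d₂₃)
    , (k + i , d₅₁ , d₅₂)
    , (e + k + j , d₅₄ , d₅₃) ) ,
    (k , split⇒≤ split₅ , refl)
    where
    v₁ = pathV P i
    v₂ = pathV P (suc i)
    v₃ = pathV Q (j + δ)
    v₄ = pathV Q (suc (j + δ))
    v₅ = pathV R k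

    split₁ : i + suc (i + δ) ≡ L P
    split₁ rewrite hP = solve (i ∷ e ∷ d ∷ [])
    split₂ : suc i + (i + δ) ≡ L P
    split₂ rewrite hP = solve (i ∷ e ∷ d ∷ [])
    split₃ : j + δ + suc j ≡ L Q
    split₃ rewrite hQ = solve (j ∷ e ∷ d ∷ [])
    split₄ : suc (j + δ) + j ≡ L Q
    split₄ rewrite hQ = solve (j ∷ e ∷ d ∷ [])
    split₅ : k + (e + k) ≡ L R
    split₅ rewrite hR = solve (k ∷ e ∷ [])

    balanced-by : ∀ {a b c} → a + c ≡ b → c ≤ suc δ → ∀ U → ∣ a - b ∣ ≤ L U
    balanced-by {a} {c = c} refl c≤ U = subst (_≤ L U) (sym (∣m-m+n∣≡n a c)) (≤-trans c≤ (long U))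

    bal₁ : ∀ U → ∣ i - suc (i + δ) ∣ ≤ L U
    bal₁ = balanced-by (+-suc i δ) ≤-refl
    bal₂ : ∀ U → ∣ suc i - i + δ ∣ ≤ L U
    bal₂ = balanced-by (sym (+-suc i (e + d))) (≤-trans (n≤1+n _) (n≤1+n _))
    bal₅ : ∀ U → ∣ k - e + k ∣ ≤ L U
    bal₅ = balanced-by (+-comm k e) (≤-trans (m≤m+n e d) (≤-trans (n≤1+n _) (n≤1+n _)))

    pos : ∀ U → 0 < L U
    pos U = ≤-trans (s≤s z≤n) (long U)

    d₁₃ : Dist E v₁ v₃ (i + (j + δ))
    d₁₃ = dist-via-start Q≢P i (suc (i + δ)) (j + δ) (suc j) split₁ split₃ bal₁
            (i + (j + δ)) 2 refl (solve (i ∷ j ∷ e ∷ d ∷ []))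
    d₂₄ : Dist E v₂ v₄ (i + (j + δ))
    d₂₄ = dist-via-end Q≢P (suc i) (i + δ) (suc (j + δ)) j split₂ split₄ bal₂ pos
            (i + (j + δ)) 2 (solve (i ∷ j ∷ e ∷ d ∷ [])) (solve (i ∷ j ∷ e ∷ d ∷ []))
    d₁₄ : Dist E v₁ v₄ (suc (i + (j + δ)))
    d₁₄ = dist-via-start Q≢P i (suc (i + δ)) (suc (j + δ)) j split₁ split₄ bal₁
            (suc (i + (j + δ))) 0 (solve (i ∷ j ∷ e ∷ d ∷ [])) (solve (i ∷ j ∷ e ∷ d ∷ []))
    d₂₃ : Dist E v₂ v₃ (suc (i + (j + δ)))
    d₂₃ = dist-via-start Q≢P (suc i) (i + δ) (j + δ) (suc j) split₂ split₃ bal₂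
            (suc (i + (j + δ))) 0 refl (solve (i ∷ j ∷ e ∷ d ∷ []))
    d₅₁ : Dist E v₅ v₁ (k + i)
    d₅₁ = dist-via-start P≢R k (e + k) i (suc (i + δ)) split₅ split₁ bal₅
            (k + i) (e + suc δ) refl (solve (i ∷ k ∷ e ∷ d ∷ []))
    d₅₂ : Dist E v₅ v₂ (suc (k + i))
    d₅₂ = dist-via-start P≢R k (e + k) (suc i) (i + δ) split₅ split₂ bal₅
            (suc (k + i)) (e + e + d) (solve (i ∷ k ∷ [])) (solve (i ∷ k ∷ e ∷ d ∷ []))
    d₅₄ : Dist E v₅ v₄ (e + k + j)
    d₅₄ = dist-via-end Q≢R k (e + k) (suc (j + δ)) j split₅ split₄ bal₅ pos
            (e + k + j) (suc (suc d)) refl (solve (j ∷ k ∷ e ∷ d ∷ []))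
    d₅₃ : Dist E v₅ v₃ (suc (e + k + j))
    d₅₃ = dist-via-end Q≢R k (e + k) (j + δ) (suc j) split₅ split₃ bal₅ pos
            (suc (e + k + j)) d (solve (j ∷ k ∷ e ∷ [])) (solve (j ∷ k ∷ e ∷ d ∷ []))

  tanaka-even-even-even : ∀ P Q R → Q ≢ P → P ≢ R → Q ≢ R → 2 ∣ L P → 2 ∣ L Q → 2 ∣ L R →
                          (∀ U → 2 ≤ L U) → AdmitsTanakaWith α β γ (OnPath R)
  tanaka-even-even-even P Q R Q≢P P≢R Q≢R 2∣P 2∣Q 2∣R long
    with even-≥ 1 2∣P (long P) | even-≥ 1 2∣Q (long Q) | even-≥ 0 2∣R z≤n
  ... | i , hP | j , hQ | k , hR = tanaka-config P Q R Q≢P P≢R Q≢R i j k 0 0 1 refl hP hQ hR long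

  tanaka-even-even-odd : ∀ P Q R → Q ≢ P → P ≢ R → Q ≢ R → 2 ∣ L P → 2 ∣ L Q → ¬ 2 ∣ L R →
                         (∀ U → 4 ≤ L U) → AdmitsTanakaWith α β γ (OnPath R)
  tanaka-even-even-odd P Q R Q≢P P≢R Q≢R 2∣P 2∣Q ∤R long
    with even-≥ 2 2∣P (long P) | even-≥ 2 2∣Q (long Q) | ∤2⇒odd (L R) ∤R
  ... | i , hP | j , hQ | k , hR = tanaka-config P Q R Q≢P P≢R Q≢R i j k 1 1 3 refl hP hQ hR long

  tanaka-odd-odd : ∀ P Q R → Q ≢ P → P ≢ R → Q ≢ R → ¬ 2 ∣ L P → ¬ 2 ∣ L Q →
                   (∀ U → 3 ≤ L U) → AdmitsTanakaWith α β γ (OnPath R)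
  tanaka-odd-odd P Q R Q≢P P≢R Q≢R ∤P ∤Q long
    with odd-≥ 1 ∤P (long P) | odd-≥ 1 ∤Q (long Q) | 2 ∣? L R
  ... | i , hP | j , hQ | yes 2∣R with even-≥ 0 2∣R z≤n
  ...   | k , hR = tanaka-config P Q R Q≢P P≢R Q≢R i j k 0 1 2 refl hP hQ hR long
  tanaka-odd-odd P Q R Q≢P P≢R Q≢R ∤P ∤Q long | i , hP | j , hQ | no ∤R with ∤2⇒odd (L R) ∤R
  ...   | k , hR = tanaka-config P Q R Q≢P P≢R Q≢R i j k 1 0 2 refl hP hQ hR long

  tanaka-on-z-path : 2 ≤ α → 2 ≤ β → 2 ≤ γ →
                     (α ≡ 2 × 2 ∣ β × 2 ∣ γ)
                       ⊎ (4 ≤ α × 4 ≤ β × 2 ∣ α × 2 ∣ β × γ ≢ 3)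
                       ⊎ (3 ≤ α × 3 ≤ β × ¬ 2 ∣ α × ¬ 2 ∣ β × 3 ≤ γ) →
                     AdmitsTanakaWith α β γ (OnPath Z)
  tanaka-on-z-path a b c (inj₁ (α≡2 , 2∣β , 2∣γ)) =
    tanaka-even-even-even X Y Z (λ ()) (λ ()) (λ ()) (subst (2 ∣_) (sym α≡2) ∣-refl) 2∣β 2∣γ
      (for-all-paths a b c)
  tanaka-on-z-path a b c (inj₂ (inj₁ (a₄ , b₄ , 2∣α , 2∣β , γ≢3))) with 2 ∣? γ
  ... | yes 2∣γ = tanaka-even-even-even X Y Z (λ ()) (λ ()) (λ ()) 2∣α 2∣β 2∣γ (for-all-paths a b c)
  ... | no  ∤γ  = tanaka-even-even-odd X Y Z (λ ()) (λ ()) (λ ()) 2∣α 2∣β ∤γ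
                    (for-all-paths a₄ b₄ (4≤-odd≢3 c ∤γ γ≢3))
  tanaka-on-z-path a b c (inj₂ (inj₂ (a₃ , b₃ , ∤α , ∤β , c₃))) =
    tanaka-odd-odd X Y Z (λ ()) (λ ()) (λ ()) ∤α ∤β (for-all-paths a₃ b₃ c₃)

  -- Two of the three lengths have the same parity.
  tanaka-of-lengths-≥4 : 4 ≤ α → 4 ≤ β → 4 ≤ γ → AdmitsTanakaWith α β γ (λ _ → ⊤)
  tanaka-of-lengths-≥4 a b c = weaken-admits (λ _ → tt) (proj₂ (pick (2 ∣? α) (2 ∣? β) (2 ∣? γ)))
    where
    long : ∀ {n} → n ≤ 4 → ∀ U → n ≤ L U
    long n≤4 U = ≤-trans n≤4 (for-all-paths a b c U)

    pick : Dec (2 ∣ α) → Dec (2 ∣ β) → Dec (2 ∣ γ) → Σ Tag λ R → AdmitsTanakaWith α β γ (OnPath R)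
    pick (yes eα) (yes eβ) (yes eγ) =
      Z , tanaka-even-even-even X Y Z (λ ()) (λ ()) (λ ()) eα eβ eγ (long (m≤m+n 2 2))
    pick (yes eα) (yes eβ) (no  oγ) =
      Z , tanaka-even-even-odd X Y Z (λ ()) (λ ()) (λ ()) eα eβ oγ (long ≤-refl)
    pick (yes eα) (no  oβ) (yes eγ) =
      Y , tanaka-even-even-odd X Z Y (λ ()) (λ ()) (λ ()) eα eγ oβ (long ≤-refl)
    pick (no  oα) (yes eβ) (yes eγ) =
      X , tanaka-even-even-odd Y Z X (λ ()) (λ ()) (λ ()) eβ eγ oα (long ≤-refl)
    pick (no  oα) (no  oβ) _ =
      Z , tanaka-odd-odd X Y Z (λ ()) (λ ()) (λ ()) oα oβ (long (n≤1+n 3))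
    pick (no  oα) (yes _)  (no  oγ) =
      Y , tanaka-odd-odd X Z Y (λ ()) (λ ()) (λ ()) oα oγ (long (n≤1+n 3))
    pick (yes _)  (no  oβ) (no  oγ) =
      X , tanaka-odd-odd Y Z X (λ ()) (λ ()) (λ ()) oβ oγ (long (n≤1+n 3))

proposition5p6 : ((α β γ : ℕ) → 2 ≤ α → 2 ≤ β → 2 ≤ γ →
    ((α ≡ 2 × 2 ∣ β × 2 ∣ γ)
    ⊎ (4 ≤ α × 4 ≤ β × 2 ∣ α × 2 ∣ β × ¬ (γ ≡ 3))
    ⊎ (3 ≤ α × 3 ≤ β × ¬ (2 ∣ α) × ¬ (2 ∣ β) × 3 ≤ γ)) →
    AdmitsTanakaWith α β γ OnZPath)
    ×
    ((α β γ : ℕ) → 4 ≤ α → 4 ≤ β → 4 ≤ γ →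
    AdmitsTanakaWith α β γ (λ _ → ⊤))
proposition5p6 = Theta.tanaka-on-z-path , Theta.tanaka-of-lengths-≥4
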